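{- (Subsumption of Lisbon Logic.) In the nondeterministic (Boolean semiring) interpretation, for every well-formed program $C$ and all $P,Q\subseteq\Sigma$, the following are equivalent: (i) $\models\langle [P]\rangle\, C\,\langle\lozenge Q\rangle$; (ii) $P\subseteq\mathsf{Dia}_C(Q)$; (iii) the Lisbon triple for $P$, $C$, $Q$ is valid.
   Context: The semiring is $\mathsf{Bool}=\langle\{0,1\},\lor,\land,0,1\rangle$. $\mathcal W(\Sigma)$ is the set of functions $m:\Sigma\to\{0,1\}$ (i.e. sets of states), $\mathrm{supp}(m)=\{\sigma:m(\sigma)=1\}$, $|m|=\bigvee_{\sigma}m(\sigma)$; $\eta(\sigma)$ is the singleton at $\sigma$; $f^\dagger(m)(\tau)=\bigvee_{\sigma\in\mathrm{supp}(m)}f(\sigma)(\tau)$. Programs $C::=\mathsf{skip}\mid C_1;C_2\mid C_1+C_2\mid\mathsf{assume}\ e\mid C^{\langle e,e'\rangle}\mid a$ ($a$ atomic with given $[\![a]\!]:\Sigma\to\mathcal W(\Sigma)$, $e$ a Boolean test over primitive tests $t\subseteq\Sigma$ or a weight in $\{0,1\}$) with semantics $[\![\mathsf{skip}]\!]=\eta$, $[\![C_1;C_2]\!](\sigma)=[\![C_2]\!]^\dagger([\![C_1]\!](\sigma))$, $[\![C_1+C_2]\!](\sigma)=[\![C_1]\!](\sigma)\lor[\![C_2]\!](\sigma)$ pointwise, $[\![\mathsf{assume}\ e]\!](\sigma)=[\![e]\!](\sigma)\cdot\eta(\sigma)$, and $[\![C^{\langle e,e'\rangle}]\!]$ the least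 fixed point of $\Phi(f)(\sigma)=[\![e]\!](\sigma)\cdot f^\dagger([\![C]\!](\sigma))\lor[\![e']\!](\sigma)\cdot\eta(\sigma)$. Outcome assertions are subsets of $\mathcal W(\Sigma)$; $[P]=\{m:|m|=1,\ \mathrm{supp}(m)\subseteq P\}$; $\lozenge Q=\{m:\mathrm{supp}(m)\cap Q\neq\emptyset\}$. $\models\langle\varphi\rangle C\langle\psi\rangle$ iff $[\![C]\!]^\dagger(m)\in\psi$ for all $m\in\varphi$. $\mathsf{Dia}_C(Q)=\{\sigma:\mathrm{supp}([\![C]\!](\sigma))\cap Q\neq\emptyset\}$. The Lisbon triple for $P,C,Q$ is valid iff for every $\sigma\in P$ there exists $\tau\in\mathrm{supp}([\![C]\!](\sigma))$ with $\tau\in Q$. -}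

module Defs where

open import Level using (Level; 0ℓ) renaming (suc to lsuc)
open import Data.Product using (Σ-syntax; ∃-syntax; _×_; _,_)
open import Data.Sum using (_⊎_)
open import Data.Empty using (⊥)
open import Data.Unit using (⊤)
open import Relation.Nullary using (¬_)
open import Relation.Binary.PropositionalEquality using (_≡_)

-- Boolean-semiring weightings over a state space S, read as subsets of S
-- (a proposition-valued predicate; m σ inhabited  ⇔  m(σ) = 1).
W : Set → Set₁
W S = S → Set

supp : {S : Set} → W S → (S → Set)
supp m = m

mass1 : {S : Set} → W S → Set
mass1 {S} m = ∃[ σ ] m σ

η : {S : Set} → S → W S
η σ τ = σ ≡ τ

_† : {S : Set} → (S → W S) → W S → W S
(f †) m τ = ∃[ σ ] (supp m σ × f σ τ)

data Test (S : Set) : Set₁ where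
  wt0  : Test S
  wt1  : Test S
  prim : (S → Set) → Test S
  not  : Test S → Test S
  _and_ : Test S → Test S → Test S
  _or_  : Test S → Test S → Test S

⟦_⟧e : {S : Set} → Test S → S → Set
⟦ wt0 ⟧e σ = ⊥
⟦ wt1 ⟧e σ = ⊤
⟦ prim t ⟧e σ = t σ
⟦ not e ⟧e σ = ¬ ⟦ e ⟧e σ
⟦ e and e' ⟧e σ = ⟦ e ⟧e σ × ⟦ e' ⟧e σ
⟦ e or e' ⟧e σ = ⟦ e ⟧e σ ⊎ ⟦ e' ⟧e σ

-- Programs; an atomic action is given directly by its semantics [[a]] : S → W S
data Prog (S : Set) : Set₁ where
  skip   : Prog S
  _⨾_    : Prog S → Prog S → Prog S
  _⊕_    : Prog S → Prog S → Prog S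
  assume : Test S → Prog S
  iter   : Prog S → Test S → Test S → Prog S
  atom   : (S → W S) → Prog S

-- Least fixed point of  Φ(f)(σ) = [[e]](σ)·f†([[C]](σ)) ∨ [[e']](σ)·η(σ),
-- given body semantics R = [[C]]: the inductive type generated by Φ.
data Lfp {S : Set} (R : S → W S) (e e' : S → Set) : S → W S where
  loop : ∀ {σ τ} → e σ → ((λ ρ → Lfp R e e' ρ) †) (R σ) τ → Lfp R e e' σ τ
  stop : ∀ {σ τ} → e' σ → η σ τ → Lfp R e e' σ τ

⟦_⟧ : {S : Set} → Prog S → S → W S
⟦ skip ⟧ = η
⟦ C₁ ⨾ C₂ ⟧ σ = (⟦ C₂ ⟧ †) (⟦ C₁ ⟧ σ)
⟦ C₁ ⊕ C₂ ⟧ σ τ = ⟦ C₁ ⟧ σ τ ⊎ ⟦ C₂ ⟧ σ τ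
⟦ assume e ⟧ σ τ = ⟦ e ⟧e σ × η σ τ
⟦ iter C e e' ⟧ = Lfp ⟦ C ⟧ ⟦ e ⟧e ⟦ e' ⟧e
⟦ atom a ⟧ = a

Assertion : Set → Set₂
Assertion S = W S → Set₁

[_] : {S : Set} → (S → Set) → Assertion S
[ P ] m = Level.Lift _ (mass1 m × (∀ σ → supp m σ → P σ))

◇ : {S : Set} → (S → Set) → Assertion S
◇ Q m = Level.Lift _ (∃[ σ ] (supp m σ × Q σ))

⊨⟨_⟩_⟨_⟩ : {S : Set} → Assertion S → Prog S → Assertion S → Set₁
⊨⟨ φ ⟩ C ⟨ ψ ⟩ = ∀ m → φ m → ψ ((⟦ C ⟧ †) m)

Dia : {S : Set} → Prog S → (S → Set) → S → Set
Dia C Q σ = ∃[ τ ] (supp (⟦ C ⟧ σ) τ × Q τ)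

_⊆_ : {S : Set} → (S → Set) → (S → Set) → Set
P ⊆ Q = ∀ σ → P σ → Q σ

Lisbon : {S : Set} → (S → Set) → Prog S → (S → Set) → Set
Lisbon P C Q = ∀ σ → P σ → ∃[ τ ] (supp (⟦ C ⟧ σ) τ × Q τ)

-- Validity against [ P ] reduces to singleton preconditions η σ with σ ∈ P, because
-- (f †) (η σ) = f σ; conversely, a Q-state reachable from any one state of a nonempty
-- m ⊆ P already lies in the support of (f †) m. The Lisbon triple is P ⊆ Dia C Q unfolded.
module Submission where

open import Defs
open import Data.Product using (_×_; _,_)
open import Function.Bundles using (_⇔_; mk⇔)
open import Function.Construct.Identity using (⇔-id)
open import Level using (lift)
open import Relation.Binary.PropositionalEquality using (refl; subst)

†-η : {S : Set} (f : S → W S) {σ τ : S} → (f †) (η σ) τ → f σ τ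
†-η f (_ , refl , fστ) = fστ

η∈[_] : {S : Set} (P : S → Set) {σ : S} → P σ → [ P ] (η σ)
η∈[ P ] p = lift ((_ , refl) , λ _ σ≡σ′ → subst P σ≡σ′ p)

valid⇒⊆Dia : {S : Set} (C : Prog S) (P Q : S → Set) →
  ⊨⟨ [ P ] ⟩ C ⟨ ◇ Q ⟩ → P ⊆ Dia C Q
valid⇒⊆Dia C P Q valid σ p =
  let lift (τ , στ , q) = valid (η σ) (η∈[ P ] p)
  in τ , †-η ⟦ C ⟧ στ , q

⊆Dia⇒valid : {S : Set} (C : Prog S) (P Q : S → Set) →
  P ⊆ Dia C Q → ⊨⟨ [ P ] ⟩ C ⟨ ◇ Q ⟩
⊆Dia⇒valid C P Q P⊆Dia m (lift ((σ , mσ) , m⊆P)) =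
  let τ , στ , q = P⊆Dia σ (m⊆P σ mσ)
  in lift (τ , (σ , mσ , στ) , q)

theorem5p2 : {S : Set} (C : Prog S) (P Q : S → Set) →
    (⊨⟨ [ P ] ⟩ C ⟨ ◇ Q ⟩ ⇔ (P ⊆ Dia C Q)) × ((P ⊆ Dia C Q) ⇔ Lisbon P C Q)
theorem5p2 C P Q = mk⇔ (valid⇒⊆Dia C P Q) (⊆Dia⇒valid C P Q) , ⇔-id _
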